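{- Let $n\ge4$ be even and set $k=\frac n2-2$. Then $$w_n=[2,0][4,0]\cdots[n-2,0][n,0]\,[n-k,n-2k][n-k+1,n-2k+2]\cdots[n-1,n-2][n,n],$$ i.e. $w_n=\prod_{j=1}^{n/2}(s_{2j}s_{2j-1}\cdots s_2s_1)\cdot\prod_{j=0}^{k}(s_{n-k+j}s_{n-k+j-1}\cdots s_{n-2k+2j})$ (factors multiplied left to right in increasing $j$). If $n\ge5$ is odd, the same expression with $n$ replaced by $m=n-1$ (and $k=\frac{n-1}{2}-2$) equals $w_n$.
   Context: $W(D_n)$ is the Coxeter group with generators $s_1,\dots,s_n$, where $s_1s_3$, $s_2s_3$, $s_is_{i+1}$ ($3\le i\le n-1$) have order 3 and all other pairs of distinct generators commute, realized as signed permutations of $\{\pm1,\dots,\pm n\}$ with an even number of sign changes via $s_1\mapsto(1,-2)(-1,2)$, $s_i\mapsto(i-1,i)(-(i-1),-i)$ ($i\ge2$), products being compositions of functions. Interval notation: for $j\ge i\ge2$, $[j,i]=s_js_{j-1}\cdots s_i$; for $j\ge2$, $[j,0]=s_js_{j-1}\cdots s_2s_1$. For even $n$, $w_n(1)=(-1)^{n/2}$, $w_n(i)=i$ for odd $i>1$, $w_n(i)=-(n+2-i)$ for even $i$; for odd $n$, $w_n(1)=(-1)^{(n-1)/2}$, $w_n(i)=i$ for odd $i>1$, $w_n(i)=-(n+1-i)$ for even $i$. -}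

module Defs where

open import Data.Nat as ℕ using (ℕ; zero; suc; _∸_; _/_; _%_; _≡ᵇ_)
open import Data.Integer as ℤ using (ℤ; +_; -[1+_]; -_; _^_)
open import Data.Integer.Properties using (_≟_)
open import Data.List using (List; map; upTo; foldr)
open import Data.Bool using (if_then_else_)
open import Relation.Nullary using (does)
open import Function using (_∘_; id)

-- Signed permutations of {±1,…,±n} are represented as functions ℤ → ℤ;
-- only their values on {±1,…,±n} matter.

swap₂ : ℤ → ℤ → ℤ → ℤ
swap₂ a b x =
  if does (x ≟ a) then b else
  if does (x ≟ b) then a else
  if does (x ≟ - a) then - b else
  if does (x ≟ - b) then - a else x

-- Generators: s₁ = (1,-2)(-1,2), sᵢ = (i-1,i)(-(i-1),-i) for i ≥ 2.
-- (s 0 is unused; set to the identity.)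
s : ℕ → ℤ → ℤ
s zero = id
s (suc zero) = swap₂ (+ 1) (- (+ 2))
s (suc (suc m)) = swap₂ (+ suc m) (+ suc (suc m))

prod : List (ℤ → ℤ) → ℤ → ℤ
prod = foldr (λ f g → f ∘ g) id

desc : ℕ → ℕ → ℤ → ℤ
desc top zero = id
desc top (suc c) = s top ∘ desc (top ∸ 1) c

-- Interval notation: [j,i] = s_j s_(j-1) ⋯ s_i  (j ≥ i ≥ 2)
[_,_] : ℕ → ℕ → ℤ → ℤ
[ j , i ] = desc j (suc j ∸ i)

-- [j,0] = s_j s_(j-1) ⋯ s_2 s_1   (j ≥ 2)
[_,0] : ℕ → ℤ → ℤ
[ j ,0] = desc j j

word : ℕ → ℤ → ℤ
word m =
  prod (map (λ j → [ 2 ℕ.* suc j ,0]) (upTo (m / 2)))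
  ∘ prod (map (λ j → [ m ∸ k ℕ.+ j , m ∸ 2 ℕ.* k ℕ.+ 2 ℕ.* j ]) (upTo (suc k)))
  where k = m / 2 ∸ 2

wpos : ℕ → ℕ → ℤ
wpos n i =
  if i ≡ᵇ 1 then (- (+ 1)) ^ (m / 2)
  else if i % 2 ≡ᵇ 1 then + i
  else - (+ (m ℕ.+ 2 ∸ i))
  where m = if n % 2 ≡ᵇ 0 then n else n ∸ 1

w : ℕ → ℤ → ℤ
w n (+ i) = wpos n i
w n -[1+ i ] = - wpos n (suc i)

-- Write m = 2(k + 2) for the even rank.  On positive arguments the second
-- product [k + 4, 4][k + 5, 6] ⋯ [2k + 4, 2k + 4] of the word fixes 1 and
-- sends 2 + 2u to 2 + u and 3 + 2t to k + 4 + t: it sorts the evens to the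
-- front and the odds to the back.  The first product [2,0][4,0] ⋯ [m,0] then
-- sends 1 to (-1)^(m/2), the front position 2 + u to -(m - 2u) and the back
-- position k + 4 + t to 3 + 2t, which is exactly w_m.  Every generator, hence
-- the whole word, commutes with negation, so the values on -i follow.  For
-- odd n = m + 1 nothing changes: w_n agrees with w_m on 1, …, m, and both the
-- word and w_n fix n.
module Submission where

open import Defs
open import Data.Nat using (ℕ; _≤_; _∸_)
open import Data.Nat.Divisibility using (_∣_)
open import Data.Integer using (+_; -_)
open import Data.Product using (_×_)
open import Relation.Nullary using (¬_)
open import Relation.Binary.PropositionalEquality using (_≡_)

open import Data.Nat using (zero; suc; _+_; _*_; _<_; z≤n; s≤s; s≤s⁻¹; _/_; _%_)
open import Data.Nat.Properties
  using ( +-suc; +-comm; +-identityʳ; *-suc; m+n∸m≡n; m+n∸n≡m; ∸-+-assoc; suc-injective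
        ; m≤m+n; m≤n+m; n<1+n; n≤1+n; m≤n⇒m≤1+n; +-monoˡ-≤; +-monoʳ-<; m≤n⇒m<n∨m≡n
        ; ≤-refl; ≤-reflexive; ≤-trans; <-trans; <⇒≢; >⇒≢ )
open import Data.Nat.DivMod using (m*n/n≡m; m*n%n≡0; [m+kn]%n≡m%n; m≡m%n+[m/n]*n; m%n<n)
open import Data.Nat.Divisibility using (divides; m%n≡0⇒n∣m)
open import Data.Nat.Tactic.RingSolver using (solve-∀)
open import Data.Integer using (ℤ; _^_)
open import Data.Integer.Properties
  using (_≟_; neg-involutive; neg-injective; +-injective; -1*i≡-i)
open import Data.List using ([]; _∷_; _∷ʳ_; map; upTo; applyUpTo)
open import Data.List.Properties using (upTo-∷ʳ; map-++; map-upTo)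
open import Data.Product using (∃; _,_)
open import Data.Sum using (inj₁; inj₂)
open import Data.Empty using (⊥-elim)
open import Function using (_∘_; id)
open import Relation.Nullary using (Dec; yes; no)
open import Relation.Nullary.Decidable using (dec-true; dec-false)
open import Relation.Binary.PropositionalEquality
  using (_≢_; _≗_; refl; sym; trans; cong; cong₂; subst; module ≡-Reasoning)

open ≡-Reasoning

Odd : (ℤ → ℤ) → Set
Odd f = ∀ x → f (- x) ≡ - f x

∘-odd : ∀ {f g} → Odd f → Odd g → Odd (f ∘ g)
∘-odd {f} {g} f-odd g-odd x = trans (cong f (g-odd x)) (f-odd (g x))

neg-transpose : ∀ {x y : ℤ} → - x ≡ y → x ≡ - y
neg-transpose {x} e = trans (sym (neg-involutive x)) (cong -_ e)

+-suc² : ∀ m n → m + suc (suc n) ≡ suc (suc (m + n))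
+-suc² m n = trans (+-suc m (suc n)) (cong suc (+-suc m n))

swap₂-left : ∀ a b → swap₂ a b a ≡ b
swap₂-left a b rewrite dec-true (a ≟ a) refl = refl

swap₂-right : ∀ {a b} → a ≢ b → swap₂ a b b ≡ a
swap₂-right {a} {b} a≢b
  rewrite dec-false (b ≟ a) (a≢b ∘ sym) | dec-true (b ≟ b) refl = refl

swap₂-neg-left : ∀ {a b} → - a ≢ a → - a ≢ b → swap₂ a b (- a) ≡ - b
swap₂-neg-left {a} {b} p q
  rewrite dec-false (- a ≟ a) p | dec-false (- a ≟ b) q | dec-true (- a ≟ - a) refl = refl

swap₂-neg-right : ∀ {a b} → - b ≢ a → - b ≢ b → - b ≢ - a → swap₂ a b (- b) ≡ - a
swap₂-neg-right {a} {b} p q r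
  rewrite dec-false (- b ≟ a) p | dec-false (- b ≟ b) q | dec-false (- b ≟ - a) r
        | dec-true (- b ≟ - b) refl = refl

swap₂-fixes : ∀ {a b x} → x ≢ a → x ≢ b → x ≢ - a → x ≢ - b → swap₂ a b x ≡ x
swap₂-fixes {a} {b} {x} p q r t
  rewrite dec-false (x ≟ a) p | dec-false (x ≟ b) q | dec-false (x ≟ - a) r
        | dec-false (x ≟ - b) t = refl

swap₂-odd : ∀ {a b} → a ≢ b → a ≢ - a → b ≢ - b → a ≢ - b → Odd (swap₂ a b)
swap₂-odd {a} {b} a≢b a≢-a b≢-b a≢-b x = by-cases (x ≟ a) (x ≟ b) (x ≟ - a) (x ≟ - b)
  where
  -a↦-b : swap₂ a b (- a) ≡ - b
  -a↦-b = swap₂-neg-left (a≢-a ∘ sym) (a≢-b ∘ neg-transpose)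

  -b↦-a : swap₂ a b (- b) ≡ - a
  -b↦-a = swap₂-neg-right (a≢-b ∘ sym) (b≢-b ∘ sym) (a≢b ∘ sym ∘ neg-injective)

  by-cases : Dec (x ≡ a) → Dec (x ≡ b) → Dec (x ≡ - a) → Dec (x ≡ - b) →
             swap₂ a b (- x) ≡ - swap₂ a b x
  by-cases (yes refl) _ _ _ = trans -a↦-b (cong -_ (sym (swap₂-left a b)))
  by-cases (no _) (yes refl) _ _ = trans -b↦-a (cong -_ (sym (swap₂-right a≢b)))
  by-cases (no _) (no _) (yes refl) _ = begin
    swap₂ a b (- - a)  ≡⟨ cong (swap₂ a b) (neg-involutive a) ⟩
    swap₂ a b a        ≡⟨ swap₂-left a b ⟩
    b                  ≡⟨ neg-involutive b ⟨
    - - b              ≡⟨ cong -_ -a↦-b ⟨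
    - swap₂ a b (- a)  ∎
  by-cases (no _) (no _) (no _) (yes refl) = begin
    swap₂ a b (- - b)  ≡⟨ cong (swap₂ a b) (neg-involutive b) ⟩
    swap₂ a b b        ≡⟨ swap₂-right a≢b ⟩
    a                  ≡⟨ neg-involutive a ⟨
    - - a              ≡⟨ cong -_ -b↦-a ⟨
    - swap₂ a b (- b)  ∎
  by-cases (no x≢a) (no x≢b) (no x≢-a) (no x≢-b) = begin
    swap₂ a b (- x)  ≡⟨ swap₂-fixes (x≢-a ∘ neg-transpose) (x≢-b ∘ neg-transpose)
                                    (x≢a ∘ neg-injective) (x≢b ∘ neg-injective) ⟩
    - x              ≡⟨ cong -_ (swap₂-fixes x≢a x≢b x≢-a x≢-b) ⟨
    - swap₂ a b x    ∎

s-odd : ∀ i → Odd (s i)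
s-odd zero x = refl
s-odd (suc zero) = swap₂-odd (λ ()) (λ ()) (λ ()) (λ ())
s-odd (suc (suc m)) = swap₂-odd (<⇒≢ ≤-refl ∘ +-injective) (λ ()) (λ ()) (λ ())

s-up : ∀ m → s (2 + m) (+ suc m) ≡ + (2 + m)
s-up m = swap₂-left (+ suc m) (+ (2 + m))

s-down : ∀ m → s (2 + m) (+ (2 + m)) ≡ + suc m
s-down m = swap₂-right (<⇒≢ ≤-refl ∘ +-injective)

s-fixes-below : ∀ m {x} → x ≤ m → s (2 + m) (+ x) ≡ + x
s-fixes-below m x≤m =
  swap₂-fixes (<⇒≢ (s≤s x≤m) ∘ +-injective) (<⇒≢ (s≤s (m≤n⇒m≤1+n x≤m)) ∘ +-injective)
              (λ ()) (λ ())

s-fixes-above : ∀ m {x} → 2 + m < x → s (2 + m) (+ x) ≡ + x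
s-fixes-above m m<x =
  swap₂-fixes (>⇒≢ (<-trans (n<1+n _) m<x) ∘ +-injective) (>⇒≢ m<x ∘ +-injective)
              (λ ()) (λ ())

s₁-fixes : ∀ x → s 1 (+ (3 + x)) ≡ + (3 + x)
s₁-fixes x = swap₂-fixes {+ 1} { - (+ 2)} (λ ()) (λ ()) (λ ()) (λ ())

desc-odd : ∀ t c → Odd (desc t c)
desc-odd t zero x = refl
desc-odd t (suc c) = ∘-odd (s-odd t) (desc-odd (t ∸ 1) c)

interval-odd : ∀ j i → Odd [ j , i ]
interval-odd j i = desc-odd j (suc j ∸ i)

desc-bottom : ∀ t c → desc t (suc c) ≗ desc t c ∘ s (t ∸ c)
desc-bottom t zero x = refl
desc-bottom t (suc c) x = begin
  s t (desc (t ∸ 1) (suc c) x)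
    ≡⟨ cong (s t) (desc-bottom (t ∸ 1) c x) ⟩
  s t (desc (t ∸ 1) c (s (t ∸ 1 ∸ c) x))
    ≡⟨ cong (λ i → s t (desc (t ∸ 1) c (s i x))) (∸-+-assoc t 1 c) ⟩
  s t (desc (t ∸ 1) c (s (t ∸ suc c) x))  ∎

cycle : ℕ → ℕ → ℤ → ℤ
cycle b c = desc (2 + (c + b)) (suc c)

cycle-odd : ∀ b c → Odd (cycle b c)
cycle-odd b c = desc-odd (2 + (c + b)) (suc c)

cycle-bottom : ∀ b c → cycle b c (+ suc b) ≡ + (2 + (c + b))
cycle-bottom b zero = s-up b
cycle-bottom b (suc c) = trans (cong (s (3 + (c + b))) (cycle-bottom b c)) (s-up (suc (c + b)))

cycle-below : ∀ b c {x} → x ≤ b → cycle b c (+ x) ≡ + x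
cycle-below b zero x≤b = s-fixes-below b x≤b
cycle-below b (suc c) x≤b =
  trans (cong (s (3 + (c + b))) (cycle-below b c x≤b))
        (s-fixes-below (suc (c + b)) (m≤n⇒m≤1+n (≤-trans x≤b (m≤n+m b c))))

cycle-above : ∀ b c {x} → 2 + (c + b) < x → cycle b c (+ x) ≡ + x
cycle-above b zero top<x = s-fixes-above b top<x
cycle-above b (suc c) top<x =
  trans (cong (s (3 + (c + b))) (cycle-above b c (<-trans (n<1+n _) top<x)))
        (s-fixes-above (suc (c + b)) top<x)

cycle-shift : ∀ b c {d} → d ≤ c → cycle b c (+ (2 + (d + b))) ≡ + suc (d + b)
cycle-shift b zero z≤n = s-down b
cycle-shift b (suc c) {d} d≤1+c with m≤n⇒m<n∨m≡n d≤1+c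
... | inj₁ (s≤s d≤c) =
  trans (cong (s (3 + (c + b))) (cycle-shift b c d≤c))
        (s-fixes-below (suc (c + b)) (s≤s (+-monoˡ-≤ b d≤c)))
... | inj₂ refl =
  trans (cong (s (3 + (c + b))) (cycle-above b c ≤-refl)) (s-down (suc (c + b)))

sweep≗cycle∘s₁ : ∀ c → [ 2 + c ,0] ≗ cycle 0 c ∘ s 1
sweep≗cycle∘s₁ c x = begin
  desc (2 + c) (2 + c) x
    ≡⟨ desc-bottom (2 + c) (suc c) x ⟩
  desc (2 + c) (suc c) (s (suc c ∸ c) x)
    ≡⟨ cong₂ (λ t i → desc (2 + t) (suc c) (s i x)) (sym (+-identityʳ c)) (m+n∸n≡m 1 c) ⟩
  desc (2 + (c + 0)) (suc c) (s 1 x)  ∎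

sweep-at-one : ∀ c → [ 2 + c ,0] (+ 1) ≡ - (+ 1)
sweep-at-one c = begin
  [ 2 + c ,0] (+ 1)    ≡⟨ sweep≗cycle∘s₁ c (+ 1) ⟩
  cycle 0 c (- (+ 2))  ≡⟨ cycle-odd 0 c (+ 2) ⟩
  - cycle 0 c (+ 2)    ≡⟨ cong -_ (cycle-shift 0 c z≤n) ⟩
  - (+ 1)              ∎

sweep-at-two : ∀ c → [ 2 + c ,0] (+ 2) ≡ - (+ (2 + c))
sweep-at-two c = begin
  [ 2 + c ,0] (+ 2)      ≡⟨ sweep≗cycle∘s₁ c (+ 2) ⟩
  cycle 0 c (- (+ 1))    ≡⟨ cycle-odd 0 c (+ 1) ⟩
  - cycle 0 c (+ 1)      ≡⟨ cong -_ (cycle-bottom 0 c) ⟩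
  - (+ (2 + (c + 0)))    ≡⟨ cong (λ y → - (+ (2 + y))) (+-identityʳ c) ⟩
  - (+ (2 + c))          ∎

sweep-shift : ∀ c {d} → d < c → [ 2 + c ,0] (+ (3 + d)) ≡ + (2 + d)
sweep-shift c {d} d<c = begin
  [ 2 + c ,0] (+ (3 + d))           ≡⟨ sweep≗cycle∘s₁ c _ ⟩
  cycle 0 c (s 1 (+ (3 + d)))       ≡⟨ cong (cycle 0 c) (s₁-fixes d) ⟩
  cycle 0 c (+ (3 + d))             ≡⟨ cong (λ y → cycle 0 c (+ (2 + y))) (+-identityʳ (suc d)) ⟨
  cycle 0 c (+ (2 + (suc d + 0)))   ≡⟨ cycle-shift 0 c d<c ⟩
  + suc (suc d + 0)                 ≡⟨ cong (λ y → + suc y) (+-identityʳ (suc d)) ⟩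
  + (2 + d)                         ∎

sweep-above : ∀ c {x} → 2 + c < x → [ 2 + c ,0] (+ x) ≡ + x
sweep-above c {suc (suc (suc y))} 2+c<x = begin
  [ 2 + c ,0] (+ (3 + y))      ≡⟨ sweep≗cycle∘s₁ c _ ⟩
  cycle 0 c (s 1 (+ (3 + y)))  ≡⟨ cong (cycle 0 c) (s₁-fixes y) ⟩
  cycle 0 c (+ (3 + y))        ≡⟨ cycle-above 0 c 2+[c+0]<x ⟩
  + (3 + y)                    ∎
  where
  2+[c+0]<x : 2 + (c + 0) < 3 + y
  2+[c+0]<x = subst (λ z → 2 + z < 3 + y) (sym (+-identityʳ c)) 2+c<x
sweep-above c {1} (s≤s ())
sweep-above c {2} (s≤s (s≤s ()))

prod-∷ʳ : ∀ fs f → prod (fs ∷ʳ f) ≗ prod fs ∘ f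
prod-∷ʳ [] f x = refl
prod-∷ʳ (g ∷ fs) f x = cong g (prod-∷ʳ fs f x)

prod-map-upTo-suc : ∀ (F : ℕ → ℤ → ℤ) h →
                    prod (map F (upTo (suc h))) ≗ prod (map F (upTo h)) ∘ F h
prod-map-upTo-suc F h x = begin
  prod (map F (upTo (suc h))) x   ≡⟨ cong (λ l → prod (map F l) x) (upTo-∷ʳ h) ⟨
  prod (map F (upTo h ∷ʳ h)) x    ≡⟨ cong (λ l → prod l x) (map-++ F (upTo h) (h ∷ [])) ⟩
  prod (map F (upTo h) ∷ʳ F h) x  ≡⟨ prod-∷ʳ (map F (upTo h)) (F h) x ⟩
  prod (map F (upTo h)) (F h x)   ∎

prod-map-odd : ∀ {F : ℕ → ℤ → ℤ} → (∀ j → Odd (F j)) → ∀ js → Odd (prod (map F js))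
prod-map-odd F-odd [] x = refl
prod-map-odd F-odd (j ∷ js) = ∘-odd (F-odd j) (prod-map-odd F-odd js)

sweeps : ℕ → ℤ → ℤ
sweeps h = prod (map (λ j → [ 2 * suc j ,0]) (upTo h))

sweeps-odd : ∀ h → Odd (sweeps h)
sweeps-odd h = prod-map-odd (λ j → desc-odd (2 * suc j) (2 * suc j)) (upTo h)

sweeps-step : ∀ h → sweeps (suc h) ≗ sweeps h ∘ [ 2 + 2 * h ,0]
sweeps-step h x =
  trans (prod-map-upTo-suc (λ j → [ 2 * suc j ,0]) h x)
        (cong (λ t → sweeps h ([ t ,0] x)) (*-suc 2 h))

sweeps-above : ∀ h {x} → 2 * h < x → sweeps h (+ x) ≡ + x
sweeps-above zero _ = refl
sweeps-above (suc h) {x} 2[1+h]<x = begin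
  sweeps (suc h) (+ x)             ≡⟨ sweeps-step h (+ x) ⟩
  sweeps h ([ 2 + 2 * h ,0] (+ x)) ≡⟨ cong (sweeps h) (sweep-above (2 * h) 2+2h<x) ⟩
  sweeps h (+ x)                   ≡⟨ sweeps-above h (<-trans (n<1+n _) (<-trans (n<1+n _) 2+2h<x)) ⟩
  + x                              ∎
  where
  2+2h<x : 2 + 2 * h < x
  2+2h<x = subst (_< x) (*-suc 2 h) 2[1+h]<x

sweeps-at-one : ∀ h → sweeps h (+ 1) ≡ (- (+ 1)) ^ h
sweeps-at-one zero = refl
sweeps-at-one (suc h) = begin
  sweeps (suc h) (+ 1)              ≡⟨ sweeps-step h (+ 1) ⟩
  sweeps h ([ 2 + 2 * h ,0] (+ 1))  ≡⟨ cong (sweeps h) (sweep-at-one (2 * h)) ⟩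
  sweeps h (- (+ 1))                ≡⟨ sweeps-odd h (+ 1) ⟩
  - sweeps h (+ 1)                  ≡⟨ cong -_ (sweeps-at-one h) ⟩
  - ((- (+ 1)) ^ h)                 ≡⟨ -1*i≡-i _ ⟨
  (- (+ 1)) ^ suc h                 ∎

sweeps-low : ∀ d r → sweeps (suc (d + r)) (+ (2 + d)) ≡ - (+ (2 * suc r))
sweeps-low zero r = begin
  sweeps (suc r) (+ 2)              ≡⟨ sweeps-step r (+ 2) ⟩
  sweeps r ([ 2 + 2 * r ,0] (+ 2))  ≡⟨ cong (sweeps r) (sweep-at-two (2 * r)) ⟩
  sweeps r (- (+ (2 + 2 * r)))      ≡⟨ sweeps-odd r _ ⟩
  - sweeps r (+ (2 + 2 * r))        ≡⟨ cong -_ (sweeps-above r (<-trans (n<1+n _) (n<1+n _))) ⟩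
  - (+ (2 + 2 * r))                 ≡⟨ cong (λ y → - (+ y)) (*-suc 2 r) ⟨
  - (+ (2 * suc r))                 ∎
sweeps-low (suc d) r = begin
  sweeps (suc (suc (d + r))) (+ (3 + d))
    ≡⟨ sweeps-step (suc (d + r)) _ ⟩
  sweeps (suc (d + r)) ([ 2 + 2 * suc (d + r) ,0] (+ (3 + d)))
    ≡⟨ cong (sweeps (suc (d + r))) (sweep-shift (2 * suc (d + r)) d<c) ⟩
  sweeps (suc (d + r)) (+ (2 + d))
    ≡⟨ sweeps-low d r ⟩
  - (+ (2 * suc r))  ∎
  where
  d<c : d < 2 * suc (d + r)
  d<c = ≤-trans (s≤s (m≤m+n d r)) (m≤m+n _ _)

sweeps-high : ∀ h {t} → t < h → sweeps h (+ (2 + h + t)) ≡ + (3 + t * 2)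
sweeps-high (suc h) {t} t<1+h with m≤n⇒m<n∨m≡n (s≤s⁻¹ t<1+h)
... | inj₁ t<h = begin
  sweeps (suc h) (+ (3 + (h + t)))              ≡⟨ sweeps-step h _ ⟩
  sweeps h ([ 2 + 2 * h ,0] (+ (3 + (h + t))))  ≡⟨ cong (sweeps h) (sweep-shift (2 * h) h+t<2h) ⟩
  sweeps h (+ (2 + h + t))                      ≡⟨ sweeps-high h t<h ⟩
  + (3 + t * 2)                                 ∎
  where
  h+t<2h : h + t < 2 * h
  h+t<2h = +-monoʳ-< h (subst (t <_) (sym (+-identityʳ h)) t<h)
... | inj₂ refl = begin
  sweeps (suc h) (+ (3 + h + h))
    ≡⟨ sweeps-step h _ ⟩
  sweeps h ([ 2 + 2 * h ,0] (+ (3 + h + h)))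
    ≡⟨ cong (sweeps h) (sweep-above (2 * h) (≤-reflexive 3+2h)) ⟩
  sweeps h (+ (3 + h + h))
    ≡⟨ sweeps-above h (≤-trans (m≤n+m (suc (2 * h)) 2) (≤-reflexive 3+2h)) ⟩
  + (3 + h + h)
    ≡⟨ cong (λ y → + (3 + y)) (h*2≡h+h h) ⟨
  + (3 + h * 2)  ∎
  where
  h*2≡h+h : ∀ h → h * 2 ≡ h + h
  h*2≡h+h = solve-∀
  3+2h : 3 + 2 * h ≡ 3 + h + h
  3+2h = cong (λ y → 3 + (h + y)) (+-identityʳ h)

-- ladder a n = [a + n + 1, a + 2][a + n + 2, a + 4] ⋯ [a + 2n, a + 2n]; the second
-- product of `word m` is ladder 2 (m / 2 - 1).
ladder : ℕ → ℕ → ℤ → ℤ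
ladder a zero = id
ladder a (suc n) = cycle a n ∘ ladder (2 + a) n

ladder-below : ∀ a n {x} → x ≤ a → ladder a n (+ x) ≡ + x
ladder-below a zero x≤a = refl
ladder-below a (suc n) x≤a =
  trans (cong (cycle a n) (ladder-below (2 + a) n (m≤n⇒m≤1+n (m≤n⇒m≤1+n x≤a))))
        (cycle-below a n x≤a)

ladder-at-even : ∀ a n {u} → u ≤ n → ladder a n (+ (a + u * 2)) ≡ + (a + u)
ladder-at-even a n {zero} _ = ladder-below a n (≤-reflexive (+-identityʳ a))
ladder-at-even a (suc n) {suc u} (s≤s u≤n) = begin
  cycle a n (ladder (2 + a) n (+ (a + suc u * 2)))
    ≡⟨ cong (λ y → cycle a n (ladder (2 + a) n (+ y))) (+-suc² a (u * 2)) ⟩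
  cycle a n (ladder (2 + a) n (+ (2 + a + u * 2)))
    ≡⟨ cong (cycle a n) (ladder-at-even (2 + a) n u≤n) ⟩
  cycle a n (+ (2 + (a + u)))
    ≡⟨ cong (λ y → cycle a n (+ (2 + y))) (+-comm a u) ⟩
  cycle a n (+ (2 + (u + a)))
    ≡⟨ cycle-shift a n u≤n ⟩
  + (suc u + a)
    ≡⟨ cong +_ (+-comm (suc u) a) ⟩
  + (a + suc u)  ∎

ladder-at-odd : ∀ a n {t} → t ≤ n → ladder a n (+ (suc a + t * 2)) ≡ + (suc a + n + t)
ladder-at-odd a zero {zero} _ = cong +_ (sym (+-identityʳ (suc a + 0)))
ladder-at-odd a (suc n) {zero} _ = begin
  cycle a n (ladder (2 + a) n (+ (suc a + 0)))
    ≡⟨ cong (λ y → cycle a n (ladder (2 + a) n (+ y))) (+-identityʳ (suc a)) ⟩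
  cycle a n (ladder (2 + a) n (+ suc a))
    ≡⟨ cong (cycle a n) (ladder-below (2 + a) n (n≤1+n _)) ⟩
  cycle a n (+ suc a)
    ≡⟨ cycle-bottom a n ⟩
  + (2 + (n + a))
    ≡⟨ cong +_ (arith a n) ⟩
  + (suc a + suc n + 0)  ∎
  where
  arith : ∀ a n → 2 + (n + a) ≡ suc a + suc n + 0
  arith = solve-∀
ladder-at-odd a (suc n) {suc t} (s≤s t≤n) = begin
  cycle a n (ladder (2 + a) n (+ (suc a + suc t * 2)))
    ≡⟨ cong (λ y → cycle a n (ladder (2 + a) n (+ suc y))) (+-suc² a (t * 2)) ⟩
  cycle a n (ladder (2 + a) n (+ (3 + a + t * 2)))
    ≡⟨ cong (cycle a n) (ladder-at-odd (2 + a) n t≤n) ⟩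
  cycle a n (+ (3 + a + n + t))
    ≡⟨ cycle-above a n (s≤s (s≤s (s≤s top≤))) ⟩
  + (3 + a + n + t)
    ≡⟨ cong +_ (arith a n t) ⟩
  + (suc a + suc n + suc t)  ∎
  where
  top≤ : n + a ≤ a + n + t
  top≤ = ≤-trans (≤-reflexive (+-comm n a)) (m≤m+n (a + n) t)
  arith : ∀ a n t → 3 + a + n + t ≡ suc a + suc n + suc t
  arith = solve-∀

prod-applyUpTo-ladder : ∀ a n (F : ℕ → ℤ → ℤ) →
  (∀ j r → suc (j + r) ≡ n → F j ≗ cycle (2 * j + a) r) → prod (applyUpTo F n) ≗ ladder a n
prod-applyUpTo-ladder a zero F F≗ x = refl
prod-applyUpTo-ladder a (suc n) F F≗ x =
  trans (F≗ 0 n refl _) (cong (cycle a n) (prod-applyUpTo-ladder (2 + a) n (F ∘ suc) F∘suc≗ x))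
  where
  arith : ∀ j a → 2 * suc j + a ≡ 2 * j + (2 + a)
  arith = solve-∀
  F∘suc≗ : ∀ j r → suc (j + r) ≡ n → F (suc j) ≗ cycle (2 * j + (2 + a)) r
  F∘suc≗ j r e y = trans (F≗ (suc j) r (cong suc e) y) (cong (λ b → cycle b r y) (arith j a))

interval≗cycle : ∀ {j r k} → j + r ≡ k →
  [ suc (suc k) * 2 ∸ k + j , suc (suc k) * 2 ∸ 2 * k + 2 * j ] ≗ cycle (2 * j + 2) r
interval≗cycle {j} {r} refl x = cong₂ (λ t c → desc t c x) top count
  where
  k = j + r
  top : suc (suc k) * 2 ∸ k + j ≡ 2 + (r + (2 * j + 2))
  top = begin
    suc (suc k) * 2 ∸ k + j  ≡⟨ cong (λ y → y ∸ k + j) (arith k) ⟩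
    k + (4 + k) ∸ k + j      ≡⟨ cong (_+ j) (m+n∸m≡n k (4 + k)) ⟩
    4 + (j + r) + j          ≡⟨ arith′ j r ⟩
    2 + (r + (2 * j + 2))    ∎
    where
    arith : ∀ k → suc (suc k) * 2 ≡ k + (4 + k)
    arith = solve-∀
    arith′ : ∀ j r → 4 + (j + r) + j ≡ 2 + (r + (2 * j + 2))
    arith′ = solve-∀
  bottom : suc (suc k) * 2 ∸ 2 * k + 2 * j ≡ 4 + 2 * j
  bottom = trans (cong (λ y → y ∸ 2 * k + 2 * j) (arith k))
                 (cong (_+ 2 * j) (m+n∸m≡n (2 * k) 4))
    where
    arith : ∀ k → suc (suc k) * 2 ≡ 2 * k + 4
    arith = solve-∀
  count : suc (suc (suc k) * 2 ∸ k + j) ∸ (suc (suc k) * 2 ∸ 2 * k + 2 * j) ≡ suc r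
  count = begin
    suc (suc (suc k) * 2 ∸ k + j) ∸ (suc (suc k) * 2 ∸ 2 * k + 2 * j)
      ≡⟨ cong₂ (λ u v → suc u ∸ v) top bottom ⟩
    suc (2 + (r + (2 * j + 2))) ∸ (4 + 2 * j)
      ≡⟨ cong (_∸ (4 + 2 * j)) (arith j r) ⟩
    4 + 2 * j + suc r ∸ (4 + 2 * j)
      ≡⟨ m+n∸m≡n (4 + 2 * j) (suc r) ⟩
    suc r ∎
    where
    arith : ∀ j r → suc (2 + (r + (2 * j + 2))) ≡ 4 + 2 * j + suc r
    arith = solve-∀

[h*2]%2≡0 : ∀ h → h * 2 % 2 ≡ 0
[h*2]%2≡0 h = m*n%n≡0 h 2

[1+h*2]%2≡1 : ∀ h → suc (h * 2) % 2 ≡ 1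
[1+h*2]%2≡1 h = [m+kn]%n≡m%n 1 h 2

h*2/2≡h : ∀ h → h * 2 / 2 ≡ h
h*2/2≡h h = m*n/n≡m h 2

-- Stated for a variable h: rewriting m / 2 ≡ h inside `word m` for a concrete
-- m makes the type checker unfold the division.
word-unfold : ∀ m {h} → m / 2 ≡ h → word m ≗
  sweeps h ∘ prod (map (λ j → [ m ∸ (h ∸ 2) + j , m ∸ 2 * (h ∸ 2) + 2 * j ]) (upTo (suc (h ∸ 2))))
word-unfold m refl x = refl

word≗sweeps∘ladder : ∀ k → word (suc (suc k) * 2) ≗ sweeps (suc (suc k)) ∘ ladder 2 (suc k)
word≗sweeps∘ladder k x =
  trans (word-unfold (suc (suc k) * 2) (h*2/2≡h (suc (suc k))) x)
        (cong (sweeps (suc (suc k)))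
              (trans (cong (λ l → prod l x) (map-upTo F (suc k)))
                     (prod-applyUpTo-ladder 2 (suc k) F F≗ x)))
  where
  F : ℕ → ℤ → ℤ
  F j = [ suc (suc k) * 2 ∸ k + j , suc (suc k) * 2 ∸ 2 * k + 2 * j ]
  F≗ : ∀ j r → suc (j + r) ≡ suc k → F j ≗ cycle (2 * j + 2) r
  F≗ j r e = interval≗cycle (suc-injective e)

word-odd : ∀ m → Odd (word m)
word-odd m = ∘-odd (sweeps-odd (m / 2)) (prod-map-odd {F} F-odd (upTo (suc k)))
  where
  k = m / 2 ∸ 2
  F : ℕ → ℤ → ℤ
  F j = [ m ∸ k + j , m ∸ 2 * k + 2 * j ]
  F-odd : ∀ j → Odd (F j)
  F-odd j = interval-odd (m ∸ k + j) (m ∸ 2 * k + 2 * j)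

wpos-at-one : ∀ h → wpos (h * 2) 1 ≡ (- (+ 1)) ^ h
wpos-at-one h rewrite [h*2]%2≡0 h | h*2/2≡h h = refl

wpos-at-even : ∀ u r → wpos (suc (u + r) * 2) (2 + u * 2) ≡ - (+ (2 * suc r))
wpos-at-even u r rewrite [h*2]%2≡0 (suc u) | [h*2]%2≡0 (suc (u + r)) =
  cong (λ y → - (+ y))
       (trans (cong (_∸ (2 + u * 2)) (arith u r)) (m+n∸m≡n (2 + u * 2) (2 * suc r)))
  where
  arith : ∀ u r → suc (u + r) * 2 + 2 ≡ 2 + u * 2 + 2 * suc r
  arith = solve-∀

wpos-at-odd : ∀ n t → wpos n (3 + t * 2) ≡ + (3 + t * 2)
wpos-at-odd n t rewrite [1+h*2]%2≡1 (suc t) = refl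

wpos-suc-even : ∀ h → wpos (suc (h * 2)) ≗ wpos (h * 2)
wpos-suc-even h i rewrite [h*2]%2≡0 h | [1+h*2]%2≡1 h = refl

-- The positions 1, …, 2n + 3 by parity; r is the slack n - u, resp. n - t.
data Position : ℕ → ℕ → Set where
  one  : ∀ {n} → Position n 1
  even : ∀ u r → Position (u + r) (2 + u * 2)
  odd  : ∀ t r → Position (t + r) (3 + t * 2)

position-suc : ∀ {n j} → Position n (2 + j) → Position (suc n) (4 + j)
position-suc (even u r) = even (suc u) r
position-suc (odd t r) = odd (suc t) r

position : ∀ n {i} → 1 ≤ i → i ≤ 3 + n * 2 → Position n i
position n {1} _ _ = one
position n {2} _ _ = even 0 n
position n {3} _ _ = odd 0 n
position zero {suc (suc (suc (suc _)))} _ (s≤s (s≤s (s≤s ())))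
position (suc n) {suc (suc (suc (suc j)))} _ (s≤s (s≤s i≤)) =
  position-suc (position n (s≤s z≤n) i≤)

sweeps∘ladder-at : ∀ {n i} → Position n i →
                   sweeps (suc n) (ladder 2 n (+ i)) ≡ wpos (suc n * 2) i
sweeps∘ladder-at {n} one = begin
  sweeps (suc n) (ladder 2 n (+ 1))  ≡⟨ cong (sweeps (suc n)) (ladder-below 2 n (s≤s z≤n)) ⟩
  sweeps (suc n) (+ 1)               ≡⟨ sweeps-at-one (suc n) ⟩
  (- (+ 1)) ^ suc n                  ≡⟨ wpos-at-one (suc n) ⟨
  wpos (suc n * 2) 1                 ∎
sweeps∘ladder-at (even u r) = begin
  sweeps (suc (u + r)) (ladder 2 (u + r) (+ (2 + u * 2)))
    ≡⟨ cong (sweeps (suc (u + r))) (ladder-at-even 2 (u + r) (m≤m+n u r)) ⟩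
  sweeps (suc (u + r)) (+ (2 + u))
    ≡⟨ sweeps-low u r ⟩
  - (+ (2 * suc r))
    ≡⟨ wpos-at-even u r ⟨
  wpos (suc (u + r) * 2) (2 + u * 2)  ∎
sweeps∘ladder-at (odd t r) = begin
  sweeps (suc (t + r)) (ladder 2 (t + r) (+ (3 + t * 2)))
    ≡⟨ cong (sweeps (suc (t + r))) (ladder-at-odd 2 (t + r) (m≤m+n t r)) ⟩
  sweeps (suc (t + r)) (+ (3 + (t + r) + t))
    ≡⟨ sweeps-high (suc (t + r)) (s≤s (m≤m+n t r)) ⟩
  + (3 + t * 2)
    ≡⟨ wpos-at-odd (suc (t + r) * 2) t ⟨
  wpos (suc (t + r) * 2) (3 + t * 2)  ∎

word-matches-w : ∀ k {n} → wpos n ≗ wpos (suc (suc k) * 2) →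
  ∀ i → 1 ≤ i → i ≤ 3 + suc k * 2 →
  (word (suc (suc k) * 2) (+ i) ≡ w n (+ i)) × (word (suc (suc k) * 2) (- (+ i)) ≡ w n (- (+ i)))
word-matches-w k {n} w≗ (suc i) 1≤i i≤ =
  positive , trans (word-odd (suc (suc k) * 2) (+ suc i)) (cong -_ positive)
  where
  positive : word (suc (suc k) * 2) (+ suc i) ≡ w n (+ suc i)
  positive = begin
    word (suc (suc k) * 2) (+ suc i)                 ≡⟨ word≗sweeps∘ladder k (+ suc i) ⟩
    sweeps (suc (suc k)) (ladder 2 (suc k) (+ suc i)) ≡⟨ sweeps∘ladder-at (position (suc k) 1≤i i≤) ⟩
    wpos (suc (suc k) * 2) (suc i)                   ≡⟨ w≗ (suc i) ⟨
    w n (+ suc i)                                    ∎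

odd-form : ∀ n → ¬ (2 ∣ n) → ∃ λ q → n ≡ suc (q * 2)
odd-form n 2∤n with n % 2 in eq | m≡m%n+[m/n]*n n 2 | m%n<n n 2
... | 0 | _ | _ = ⊥-elim (2∤n (m%n≡0⇒n∣m n 2 eq))
... | 1 | n≡ | _ = n / 2 , n≡
... | suc (suc _) | _ | s≤s (s≤s ())

lemma2p34 : ((n : ℕ) → 4 ≤ n → 2 ∣ n →
                 (i : ℕ) → 1 ≤ i → i ≤ n →
                 (word n (+ i) ≡ w n (+ i)) × (word n (- (+ i)) ≡ w n (- (+ i))))
              × ((n : ℕ) → 5 ≤ n → ¬ (2 ∣ n) →
                 (i : ℕ) → 1 ≤ i → i ≤ n →
                 (word (n ∸ 1) (+ i) ≡ w n (+ i)) × (word (n ∸ 1) (- (+ i)) ≡ w n (- (+ i))))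
lemma2p34 = even-rank , odd-rank
  where
  even-rank : (n : ℕ) → 4 ≤ n → 2 ∣ n → (i : ℕ) → 1 ≤ i → i ≤ n →
              (word n (+ i) ≡ w n (+ i)) × (word n (- (+ i)) ≡ w n (- (+ i)))
  even-rank _ _ (divides (suc (suc k)) refl) i 1≤i i≤n =
    word-matches-w k (λ _ → refl) i 1≤i (m≤n⇒m≤1+n i≤n)
  even-rank _ (s≤s (s≤s ())) (divides 1 refl)
  even-rank _ () (divides 0 refl)

  odd-rank : (n : ℕ) → 5 ≤ n → ¬ (2 ∣ n) → (i : ℕ) → 1 ≤ i → i ≤ n →
             (word (n ∸ 1) (+ i) ≡ w n (+ i)) × (word (n ∸ 1) (- (+ i)) ≡ w n (- (+ i)))
  odd-rank n 5≤n 2∤n with odd-form n 2∤n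
  odd-rank _ _ _ | suc (suc k) , refl = word-matches-w k (wpos-suc-even (suc (suc k)))
  odd-rank _ (s≤s (s≤s (s≤s ()))) _ | 1 , refl
  odd-rank _ (s≤s ()) _ | 0 , refl
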